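{- Let $S$ be a string of length $n$ over an alphabet $\Sigma$ and $Q\subseteq\Sigma$ with $|Q|=q\ge 2$. Let $[s_1,t_1],\ldots,[s_{\mu},t_{\mu}]$ be the minimal co-occurrences of $Q$ in $S$. Then \[\sum_{i=1}^{\mu} (t_i - s_i + 1) = O(nq).\]
   Context: An interval $[i,j]\subseteq[1,n]$ is a co-occurrence of $Q$ in $S$ if $S[i..j]$ contains each character of $Q$ at least once; it is a minimal co-occurrence if it is a co-occurrence and neither $[i+1,j]$ nor $[i,j-1]$ is a co-occurrence. -}

module Defs where

open import Data.Nat using (ℕ; suc; _≤_; _∸_)
open import Data.Fin using (Fin; toℕ)
open import Data.Vec using (Vec; lookup)
open import Data.List using (List)
open import Data.List.Relation.Unary.All using (All)
open import Data.Product using (Σ; _×_; ∃)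
open import Relation.Binary.PropositionalEquality using (_≡_)
open import Relation.Nullary using (¬_)

-- Positions of a string S : Vec A n are 1-based: position p = suc (toℕ k) for k : Fin n,
-- and the character at that position is lookup S k.

OccursIn : {A : Set} {n : ℕ} → Vec A n → ℕ → ℕ → A → Set
OccursIn {n = n} S i j c =
  ∃ λ (k : Fin n) → (i ≤ suc (toℕ k)) × (suc (toℕ k) ≤ j) × (lookup S k ≡ c)

CoOcc : {A : Set} {n : ℕ} → Vec A n → List A → ℕ → ℕ → Set
CoOcc {n = n} S Q i j =
  (1 ≤ i) × (i ≤ j) × (j ≤ n) × All (OccursIn S i j) Q

MinCoOcc : {A : Set} {n : ℕ} → Vec A n → List A → ℕ → ℕ → Set
MinCoOcc S Q i j =
  CoOcc S Q i j × ¬ CoOcc S Q (suc i) j × ¬ CoOcc S Q i (j ∸ 1)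

{-# OPTIONS --safe #-}
-- Every position p lies in at most q minimal co-occurrences: a minimal co-occurrence
-- [s,t] starts with a character of Q, and two of them through p with the same start
-- character coincide, since a repetition of S[s] inside [s+1,t] would make [s+1,t] a
-- co-occurrence. Counting each minimal co-occurrence once for every position it
-- covers, the total length is at most nq.
module Submission where

open import Defs
open import Data.Nat
  using (ℕ; zero; suc; _≤_; _<_; _∸_; _+_; _*_; z≤n; s≤s; _≤′_; ≤′-refl; ≤′-step; _≟_; _≤?_)
open import Data.Nat.Properties
open import Data.Bool using (true; false; if_then_else_)
open import Data.Fin using (toℕ)
open import Data.Fin.Properties using (toℕ-injective)
open import Data.Vec using (Vec; lookup)
open import Data.List using (List; []; _∷_; length; map; filter)
open import Data.List.Properties using (length-removeAt′)
open import Data.Nat.ListAction using (sum)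
open import Data.List.Relation.Unary.All as All using (All; []; _∷_)
open import Data.List.Relation.Unary.Any using (Any; here; there; _─_)
open import Data.List.Relation.Unary.AllPairs using (_∷_)
open import Data.List.Relation.Unary.Unique.Propositional using (Unique)
import Data.List.Relation.Unary.Unique.Propositional.Properties as Unique
open import Data.List.Membership.Propositional using (_∈_; find)
open import Data.List.Membership.Propositional.Properties using (∈-filter⁻)
open import Data.Product using (Σ; ∃; _×_; _,_; proj₁; proj₂)
open import Relation.Nullary.Decidable using (_×-dec_; dec-true)
open import Data.Sum as Sum using (_⊎_; inj₁; inj₂)
open import Data.Empty using (⊥-elim)
open import Function using (_∘_)
open import Function.Bundles using (_⇔_; Equivalence)
open import Relation.Binary using (tri<; tri≈; tri>)
open import Relation.Binary.PropositionalEquality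
open import Relation.Nullary using (¬_; Dec; does; yes; no; contradiction)
open import Algebra.Properties.CommutativeSemigroup +-commutativeSemigroup using (interchange)

private
  variable
    X Y : Set

any⊎all : {P R : X → Set} {xs : List X} → All (λ x → P x ⊎ R x) xs → Any P xs ⊎ All R xs
any⊎all [] = inj₂ []
any⊎all (inj₁ p ∷ _) = inj₁ (here p)
any⊎all (inj₂ r ∷ rs) = Sum.map there (r ∷_) (any⊎all rs)

∈-─⁺ : {x y : X} {ys : List X} (x∈ys : x ∈ ys) → y ∈ ys → x ≢ y → y ∈ (ys ─ x∈ys)
∈-─⁺ (here refl) (here refl) x≢y = contradiction refl x≢y
∈-─⁺ (here _) (there y∈ys) _ = y∈ys
∈-─⁺ (there _) (here y≡z) _ = here y≡z
∈-─⁺ (there x∈ys) (there y∈ys) x≢y = there (∈-─⁺ x∈ys y∈ys x≢y)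

length-≤-by-injection : (R : X → Y → Set) {xs : List X} {ys : List Y} → Unique xs →
  (∀ {x} → x ∈ xs → ∃ λ y → y ∈ ys × R x y) →
  (∀ {x x′ y} → x ∈ xs → x′ ∈ xs → R x y → R x′ y → x ≡ x′) →
  length xs ≤ length ys
length-≤-by-injection R {[]} _ _ _ = z≤n
length-≤-by-injection R {x ∷ xs} {ys} (x∉xs ∷ unique) image injective
  with y , y∈ys , Rxy ← image (here refl) = begin
    suc (length xs)          ≤⟨ s≤s (length-≤-by-injection R unique image′ injective′) ⟩
    suc (length (ys ─ y∈ys)) ≡⟨ sym (length-removeAt′ ys _) ⟩
    length ys                ∎
  where
  open ≤-Reasoning
  injective′ : ∀ {x x′ y} → x ∈ xs → x′ ∈ xs → R x y → R x′ y → x ≡ x′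
  injective′ m m′ = injective (there m) (there m′)
  image′ : ∀ {x′} → x′ ∈ xs → ∃ λ y′ → y′ ∈ (ys ─ y∈ys) × R x′ y′
  image′ m with y′ , y′∈ys , Rx′y′ ← image (there m) =
    y′ , ∈-─⁺ y∈ys y′∈ys y≢y′ , Rx′y′
    where
    y≢y′ : y ≢ y′
    y≢y′ refl = All.lookup x∉xs m (injective (here refl) (there m) Rxy Rx′y′)

𝟙 : {P : Set} → Dec P → ℕ
𝟙 d = if does d then 1 else 0

𝟙-accept : {P : Set} (d : Dec P) → P → 𝟙 d ≡ 1
𝟙-accept d p = cong (if_then 1 else 0) (dec-true d p)

length-filter≡sum-𝟙 : {P : X → Set} (P? : ∀ x → Dec (P x)) (xs : List X) →
  length (filter P? xs) ≡ sum (map (𝟙 ∘ P?) xs)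
length-filter≡sum-𝟙 P? [] = refl
length-filter≡sum-𝟙 P? (x ∷ xs) with does (P? x)
... | true = cong suc (length-filter≡sum-𝟙 P? xs)
... | false = length-filter≡sum-𝟙 P? xs

sum-map-mono-≤ : {f g : X → ℕ} (xs : List X) → (∀ {x} → x ∈ xs → f x ≤ g x) →
  sum (map f xs) ≤ sum (map g xs)
sum-map-mono-≤ [] _ = z≤n
sum-map-mono-≤ (x ∷ xs) f≤g = +-mono-≤ (f≤g (here refl)) (sum-map-mono-≤ xs (f≤g ∘ there))

sum-map-+ : (f g : X → ℕ) (xs : List X) →
  sum (map (λ x → f x + g x) xs) ≡ sum (map f xs) + sum (map g xs)
sum-map-+ f g [] = refl
sum-map-+ f g (x ∷ xs) =
  trans (cong (f x + g x +_) (sum-map-+ f g xs)) (interchange (f x) (g x) _ _)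

sum-map-zero : (xs : List X) → sum (map (λ _ → 0) xs) ≡ 0
sum-map-zero [] = refl
sum-map-zero (_ ∷ xs) = sum-map-zero xs

sumTo : ℕ → (ℕ → ℕ) → ℕ
sumTo zero f = 0
sumTo (suc m) f = f (suc m) + sumTo m f

sumTo-monoˡ-≤ : ∀ {m m′} (f : ℕ → ℕ) → m ≤ m′ → sumTo m f ≤ sumTo m′ f
sumTo-monoˡ-≤ f m≤m′ = go (≤⇒≤′ m≤m′)
  where
  go : ∀ {m m′} → m ≤′ m′ → sumTo m f ≤ sumTo m′ f
  go ≤′-refl = ≤-refl
  go (≤′-step m≤m′) = ≤-trans (go m≤m′) (m≤n+m _ (f _))

sum-map-sumTo-≤ : (f : ℕ → X → ℕ) (xs : List X) {q : ℕ} → (∀ p → sum (map (f p) xs) ≤ q) →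
  ∀ m → sum (map (λ x → sumTo m (λ p → f p x)) xs) ≤ m * q
sum-map-sumTo-≤ f xs _ zero = ≤-reflexive (sum-map-zero xs)
sum-map-sumTo-≤ f xs {q} bound (suc m) = begin
  sum (map (λ x → f (suc m) x + sumTo m (λ p → f p x)) xs)
    ≡⟨ sum-map-+ (f (suc m)) (λ x → sumTo m (λ p → f p x)) xs ⟩
  sum (map (f (suc m)) xs) + sum (map (λ x → sumTo m (λ p → f p x)) xs)
    ≤⟨ +-mono-≤ (bound (suc m)) (sum-map-sumTo-≤ f xs bound m) ⟩
  q + m * q ∎
  where open ≤-Reasoning

Covers : ℕ → ℕ × ℕ → Set
Covers p (s , t) = s ≤ p × p ≤ t

covers? : ∀ p x → Dec (Covers p x)
covers? p (s , t) = s ≤? p ×-dec p ≤? t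

coverage : ℕ → ℕ × ℕ → ℕ
coverage m x = sumTo m (λ p → 𝟙 (covers? p x))

length≤coverage : ∀ {s u t} → 1 ≤ s → u ≤ t → suc u ∸ s ≤ coverage u (s , t)
length≤coverage {u = zero} 1≤s _ = ≤-reflexive (m≤n⇒m∸n≡0 1≤s)
length≤coverage {s} {suc u} {t} 1≤s u<t with s ≤? suc u
... | no s≰u = ≤-trans (≤-reflexive (m≤n⇒m∸n≡0 (≰⇒> s≰u))) z≤n
... | yes s≤u = begin
  suc (suc u) ∸ s               ≡⟨ +-∸-assoc 1 s≤u ⟩
  suc (suc u ∸ s)               ≤⟨ s≤s (length≤coverage 1≤s (<⇒≤ u<t)) ⟩
  1 + coverage u (s , t)        ≡⟨ cong (_+ coverage u (s , t)) (sym suc-u-covered) ⟩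
  coverage (suc u) (s , t)      ∎
  where
  open ≤-Reasoning
  suc-u-covered : 𝟙 (covers? (suc u) (s , t)) ≡ 1
  suc-u-covered = 𝟙-accept (covers? (suc u) (s , t)) (s≤u , u<t)

module _ {A : Set} {n : ℕ} (S : Vec A n) where

  CharAt : ℕ → A → Set
  CharAt p c = ∃ λ k → suc (toℕ k) ≡ p × lookup S k ≡ c

  charAt-functional : ∀ {p c d} → CharAt p c → CharAt p d → c ≡ d
  charAt-functional (k , refl , refl) (k′ , k′≡k , refl) =
    cong (lookup S) (toℕ-injective (suc-injective (sym k′≡k)))

  charAt⇒occursIn : ∀ {i j p c} → i ≤ p → p ≤ j → CharAt p c → OccursIn S i j c
  charAt⇒occursIn i≤p p≤j (k , refl , e) = k , i≤p , p≤j , e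

  occursIn-split : ∀ {i j c} → OccursIn S i j c → CharAt i c ⊎ OccursIn S (suc i) j c
  occursIn-split {i} (k , i≤k , k≤j , e) with suc (toℕ k) ≟ i
  ... | yes k≡i = inj₁ (k , k≡i , e)
  ... | no k≢i = inj₂ (k , ≤∧≢⇒< i≤k (k≢i ∘ sym) , k≤j , e)

  coOcc-widen : ∀ {Q i j j′} → CoOcc S Q i j → j ≤ j′ → j′ ≤ n → CoOcc S Q i j′
  coOcc-widen (1≤i , i≤j , _ , occ) j≤j′ j′≤n =
    1≤i , ≤-trans i≤j j≤j′ , j′≤n ,
    All.map (λ (k , i≤k , k≤j , e) → k , i≤k , ≤-trans k≤j j≤j′ , e) occ

  minCoOcc-end-≤ : ∀ {Q s t t′} → MinCoOcc S Q s t → CoOcc S Q s t′ → t ≤ t′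
  minCoOcc-end-≤ {t = zero} _ _ = z≤n
  minCoOcc-end-≤ {t = suc t} {t′} ((_ , _ , t<n , _) , _ , ¬right) co with suc t ≤? t′
  ... | yes t<t′ = t<t′
  ... | no t≮t′ =
    contradiction (coOcc-widen co (≤-pred (≰⇒> t≮t′)) (≤-trans (n≤1+n t) t<n)) ¬right

  minCoOcc-start-unrepeated : ∀ {Q s t s′ c} → MinCoOcc S Q s t → s < s′ → s′ ≤ t →
    CharAt s c → ¬ CharAt s′ c
  minCoOcc-start-unrepeated {s = s} {t}
    ((_ , _ , t≤n , occ) , ¬left , _) s<s′ s′≤t at-s at-s′ =
    ¬left (s≤s z≤n , ≤-trans s<s′ s′≤t , t≤n , All.map shrink occ)
    where
    shrink : ∀ {d} → OccursIn S s t d → OccursIn S (suc s) t d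
    shrink occ-d with occursIn-split occ-d
    ... | inj₁ d-at-s =
      subst (OccursIn S (suc s) t) (charAt-functional at-s d-at-s) (charAt⇒occursIn s<s′ s′≤t at-s′)
    ... | inj₂ occ′ = occ′

  minCoOcc-start∈Q : ∀ {Q s t} → 1 ≤ length Q → MinCoOcc S Q s t → ∃ λ c → c ∈ Q × CharAt s c
  minCoOcc-start∈Q {_ ∷ _} _ ((_ , _ , t≤n , occ) , ¬left , _)
    with any⊎all (All.map occursIn-split occ)
  ... | inj₁ at-s = find at-s
  ... | inj₂ occ′@((_ , s<k , k≤t , _) ∷ _) =
    ⊥-elim (¬left (s≤s z≤n , ≤-trans s<k k≤t , t≤n , occ′))

  minCoOcc-start-injective : ∀ {Q p c s t s′ t′} → MinCoOcc S Q s t → MinCoOcc S Q s′ t′ →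
    Covers p (s , t) → Covers p (s′ , t′) → CharAt s c → CharAt s′ c → (s , t) ≡ (s′ , t′)
  minCoOcc-start-injective {s = s} {s′ = s′} min min′ (s≤p , p≤t) (s′≤p , p≤t′) at at′
    with <-cmp s s′
  ... | tri< s<s′ _ _ = contradiction at′ (minCoOcc-start-unrepeated min s<s′ (≤-trans s′≤p p≤t) at)
  ... | tri> _ _ s′<s = contradiction at (minCoOcc-start-unrepeated min′ s′<s (≤-trans s≤p p≤t′) at′)
  ... | tri≈ _ refl _ =
    cong (s ,_) (≤-antisym (minCoOcc-end-≤ min (proj₁ min′)) (minCoOcc-end-≤ min′ (proj₁ min)))

  minCoOccs-covering-≤ : ∀ {Q} → 1 ≤ length Q → (L : List (ℕ × ℕ)) → Unique L →
    (∀ {s t} → (s , t) ∈ L → MinCoOcc S Q s t) →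
    ∀ p → length (filter (covers? p) L) ≤ length Q
  minCoOccs-covering-≤ {Q} 1≤q L unique minimal p =
    length-≤-by-injection (λ (s , _) c → CharAt s c) (Unique.filter⁺ (covers? p) unique)
      start∈Q start-injective
    where
    start∈Q : ∀ {x} → x ∈ filter (covers? p) L → ∃ λ c → c ∈ Q × CharAt (proj₁ x) c
    start∈Q m = minCoOcc-start∈Q 1≤q (minimal (proj₁ (∈-filter⁻ (covers? p) m)))
    start-injective : ∀ {x x′ c} → x ∈ filter (covers? p) L → x′ ∈ filter (covers? p) L →
      CharAt (proj₁ x) c → CharAt (proj₁ x′) c → x ≡ x′
    start-injective m m′ =
      let x∈L , p∈x = ∈-filter⁻ (covers? p) m
          x′∈L , p∈x′ = ∈-filter⁻ (covers? p) m′
      in minCoOcc-start-injective (minimal x∈L) (minimal x′∈L) p∈x p∈x′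

  sum-length-minCoOccs-≤ : ∀ {Q} → 1 ≤ length Q → (L : List (ℕ × ℕ)) → Unique L →
    (∀ {s t} → (s , t) ∈ L → MinCoOcc S Q s t) →
    sum (map (λ (s , t) → suc t ∸ s) L) ≤ n * length Q
  sum-length-minCoOccs-≤ {Q} 1≤q L unique minimal = begin
    sum (map (λ (s , t) → suc t ∸ s) L)  ≤⟨ sum-map-mono-≤ L length≤coverageₙ ⟩
    sum (map (coverage n) L)             ≤⟨ sum-map-sumTo-≤ (λ p → 𝟙 ∘ covers? p) L covered-≤ n ⟩
    n * length Q                         ∎
    where
    open ≤-Reasoning
    length≤coverageₙ : ∀ {x} → x ∈ L → suc (proj₂ x) ∸ proj₁ x ≤ coverage n x
    length≤coverageₙ x∈L with (1≤s , _ , t≤n , _) , _ ← minimal x∈L =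
      ≤-trans (length≤coverage 1≤s ≤-refl) (sumTo-monoˡ-≤ _ t≤n)
    covered-≤ : ∀ p → sum (map (𝟙 ∘ covers? p) L) ≤ length Q
    covered-≤ p = subst (_≤ length Q) (length-filter≡sum-𝟙 (covers? p) L)
      (minCoOccs-covering-≤ 1≤q L unique minimal p)

lemma3 : Σ ℕ λ C →
    (A : Set) (n : ℕ) (S : Vec A n) (Q : List A) →
    Unique Q → 2 ≤ length Q →
    (L : List (ℕ × ℕ)) → Unique L →
    (∀ s t → ((s , t) ∈ L) ⇔ MinCoOcc S Q s t) →
    sum (map (λ { (s , t) → suc t ∸ s }) L) ≤ C * n * length Q
lemma3 = 1 , λ A n S Q _ 2≤q L unique L-enumerates-minCoOccs →
  subst (sum (map (λ (s , t) → suc t ∸ s) L) ≤_) (cong (_* length Q) (sym (*-identityˡ n)))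
    (sum-length-minCoOccs-≤ S (≤-trans (s≤s z≤n) 2≤q) L unique (Equivalence.to (L-enumerates-minCoOccs _ _)))
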